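{- For any state $r\in Q\setminus\{\textsc{start}\}$ in the automaton $\mathcal{A}_{\phi,s}$ and any $\boldsymbol{\ell}\in\{0,\dots,\mathrm{width}(\phi^2(r))-1\}\times\{0,\dots,\mathrm{height}(\phi^2(r))-1\}$ we have $\mathcal{A}_{\phi,s}(r,h(\boldsymbol{\ell})) = \phi^2(r)[\boldsymbol{\ell}]$.
   Context: $\phi$ is the 2-dimensional morphism on $\mathcal{H}=\{0,\dots,15\}$ (matrices with bottom row $=$ row 0; $(a,b)$ a horizontal domino with $a$ at $(0,0)$): $0\mapsto(14)$, $1\mapsto(13)$, $2\mapsto(12,10)$, $3\mapsto(11,8)$, $4\mapsto(14,7)$, $5\mapsto(13,7)$, $6\mapsto(12,7)$, $7\mapsto\left(\begin{smallmatrix}6\\12\end{smallmatrix}\right)$, $8\mapsto\left(\begin{smallmatrix}3\\14\end{smallmatrix}\right)$, $9\mapsto\left(\begin{smallmatrix}3\\13\end{smallmatrix}\right)$, $10\mapsto\left(\begin{smallmatrix}2\\12\end{smallmatrix}\right)$, $11\mapsto\left(\begin{smallmatrix}6&1\\12&10\end{smallmatrix}\right)$, $12\mapsto\left(\begin{smallmatrix}6&1\\11&8\end{smallmatrix}\right)$, $13\mapsto\left(\begin{smallmatrix}5&1\\15&9\end{smallmatrix}\right)$, $14\mapsto\left(\begin{smallmatrix}4&1\\11&8\end{smallmatrix}\right)$, $15\mapsto\left(\begin{smallmatrix}2&0\\12&7\end{smallmatrix}\right)$. The seed is $s_{(-1,0)}=8$, $s_{(0,0)}=12$, $s_{(-1,-1)}=1$,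 $s_{(0,-1)}=6$. The DFAO $\mathcal{A}_{\phi,s}$ has state set $Q=\mathcal{H}\cup\{\textsc{start}\}$, initial state $\textsc{start}$, input alphabet $\Sigma=\{\binom00,\binom01,\binom10,\binom11\}$, and partial transition function $\delta$ with $\delta(\textsc{start},\binom00)=s_{(0,0)}$, $\delta(\textsc{start},\binom10)=s_{(-1,0)}$, $\delta(\textsc{start},\binom01)=s_{(0,-1)}$, $\delta(\textsc{start},\binom11)=s_{(-1,-1)}$ (i.e. on the representations of $\{ -1,0\}^2$, where $0\mapsto0$ and $-1\mapsto1$), and $\delta(a,e)=b$ for $a,b\in\mathcal{H}$, $e\in\Sigma$ iff $b$ is at position $e$ in $\phi(a)$. $\mathcal{A}_{\phi,s}(r,w)$ denotes the state reached from $r$ by reading $w$. $h$ is the morphism $0\mapsto00$, $1\mapsto01$, $2\mapsto10$ applied coordinatewise to $\boldsymbol{\ell}=(\ell_1,\ell_2)$, giving a two-row word of length 2; $\mathrm{width}$ and $\mathrm{height}$ denote the horizontal and vertical size of a 2-dimensional word. -}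

module Defs where

open import Data.Nat using (ℕ; zero; suc; _∸_; _<ᵇ_)
open import Data.Nat.ListAction using (sum)
open import Data.Fin using (Fin; zero; suc; toℕ; fromℕ)
open import Data.Bool using (Bool; true; false; if_then_else_)
open import Data.Maybe using (Maybe; just; nothing; _>>=_)
open import Data.Product using (_×_; _,_; Σ)
open import Data.List using (List; []; _∷_; map; allFin)
open import Data.Vec using (Vec; lookup; _∷_; [])
open import Data.Fin using (#_)

H : Set
H = Fin 16

-- A finite 2-dimensional word: at x y is the letter in column x (horizontal
-- coordinate) and row y (vertical coordinate, row 0 = bottom row).
record Word2 : Set where
  constructor mkW
  field
    width  : ℕ
    height : ℕ
    at     : Fin width → Fin height → H
open Word2 public

one : H → Word2
one a = mkW 1 1 (λ _ _ → a)

hor : H → H → Word2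
hor a b = mkW 2 1 f
  where
  f : Fin 2 → Fin 1 → H
  f zero _ = a
  f (suc _) _ = b

ver : H → H → Word2
ver t b = mkW 1 2 f
  where
  f : Fin 1 → Fin 2 → H
  f _ zero = b
  f _ (suc _) = t

sq : H → H → H → H → Word2
sq tl tr bl br = mkW 2 2 f
  where
  f : Fin 2 → Fin 2 → H
  f zero zero = bl
  f (suc _) zero = br
  f zero (suc _) = tl
  f (suc _) (suc _) = tr


φ-table : Vec Word2 16
φ-table =
    one (# 14)
  ∷ one (# 13)
  ∷ hor (# 12) (# 10)
  ∷ hor (# 11) (# 8)
  ∷ hor (# 14) (# 7)
  ∷ hor (# 13) (# 7)
  ∷ hor (# 12) (# 7)
  ∷ ver (# 6) (# 12)
  ∷ ver (# 3) (# 14)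
  ∷ ver (# 3) (# 13)
  ∷ ver (# 2) (# 12)
  ∷ sq (# 6) (# 1) (# 12) (# 10)
  ∷ sq (# 6) (# 1) (# 11) (# 8)
  ∷ sq (# 5) (# 1) (# 15) (# 9)
  ∷ sq (# 4) (# 1) (# 11) (# 8)
  ∷ sq (# 2) (# 0) (# 12) (# 7)
  ∷ []

φ : H → Word2
φ a = lookup φ-table a

finLookup : (n : ℕ) → ℕ → Maybe (Fin n)
finLookup zero _ = nothing
finLookup (suc n) zero = just zero
finLookup (suc n) (suc k) = Data.Maybe.map suc (finLookup n k)

_[_,_] : Word2 → ℕ → ℕ → Maybe H
W [ x , y ] = finLookup (width W) x >>= λ i → finLookup (height W) y >>= λ j → just (at W i j)

-- Image φ(W) of a 2-dimensional word W: the blocks φ(W[x,y]) are concatenated;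
-- column x of blocks has the width of φ(W[x,0]) and row y of blocks has
-- the height of φ(W[0,y]).
colWidth : (W : Word2) → Fin (width W) → ℕ
colWidth (mkW w zero f) x = 0
colWidth (mkW w (suc h) f) x = width (φ (f x zero))

rowHeight : (W : Word2) → Fin (height W) → ℕ
rowHeight (mkW zero h f) y = 0
rowHeight (mkW (suc w) h f) y = height (φ (f zero y))

-- locate s k : the block index i and offset o with k = s 0 + … + s (i-1) + o, o < s i
locate : (n : ℕ) → (Fin n → ℕ) → ℕ → Maybe (Σ (Fin n) (λ _ → ℕ))
locate zero s k = nothing
locate (suc n) s k =
  if k <ᵇ s zero then just (zero , k)
  else Data.Maybe.map (λ { (i , o) → (suc i , o) }) (locate n (λ i → s (suc i)) (k ∸ s zero))

imageWidth : Word2 → ℕ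
imageWidth W = sum (map (colWidth W) (allFin (width W)))

imageHeight : Word2 → ℕ
imageHeight W = sum (map (rowHeight W) (allFin (height W)))

imageAt : Word2 → ℕ → ℕ → Maybe H
imageAt W x y =
  locate (width W) (colWidth W) x >>= λ { (i , ox) →
  locate (height W) (rowHeight W) y >>= λ { (j , oy) →
  φ (at W i j) [ ox , oy ] } }

width-φ² : H → ℕ
width-φ² r = imageWidth (φ r)

height-φ² : H → ℕ
height-φ² r = imageHeight (φ r)

φ²-at : H → ℕ → ℕ → Maybe H
φ²-at r x y = imageAt (φ r) x y

data Q : Set where
  start : Q
  st    : H → Q

-- input letter (e₁ , e₂) = column vector (e₁ over e₂); e₁ horizontal, e₂ vertical
Σin : Set
Σin = Bool × Bool

bitℕ : Bool → ℕ
bitℕ false = 0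
bitℕ true  = 1

-- seed: s(-1,0)=8, s(0,0)=12, s(-1,-1)=1, s(0,-1)=6 ; digit 1 encodes -1
seed : Σin → H
seed (false , false) = # 12
seed (true  , false) = # 8
seed (false , true)  = # 6
seed (true  , true)  = # 1

δ : Q → Σin → Maybe Q
δ start e = just (st (seed e))
δ (st a) (e₁ , e₂) = Data.Maybe.map st (φ a [ bitℕ e₁ , bitℕ e₂ ])

run : Q → List Σin → Maybe Q
run q [] = just q
run q (e ∷ w) = δ q e >>= λ q′ → run q′ w

hdig : ℕ → Maybe (Bool × Bool)
hdig 0 = just (false , false)
hdig 1 = just (false , true)
hdig 2 = just (true , false)
hdig _ = nothing

-- h(ℓ₁,ℓ₂): two-row word, top row h(ℓ₁), bottom row h(ℓ₂), read column by column
h : ℕ → ℕ → Maybe (List Σin)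
h ℓ₁ ℓ₂ = hdig ℓ₁ >>= λ { (a₁ , a₂) → hdig ℓ₂ >>= λ { (b₁ , b₂) →
  just ((a₁ , b₁) ∷ (a₂ , b₂) ∷ []) } }

runM : Q → Maybe (List Σin) → Maybe Q
runM q nothing = nothing
runM q (just w) = run q w

-- Reading h(ℓ) from state r, the automaton first reads the letter made of the
-- leading digits of h(ℓ₁) and h(ℓ₂), moving to the entry a of φ(r) at that
-- position, and then the trailing digits, moving to an entry of φ(a).  So it
-- suffices that the leading digits of h(ℓ) locate the block of φ²(r) = φ(φ(r))
-- containing ℓ and the trailing digits the offset of ℓ inside it.  The block
-- sizes along every row and column of φ²(r) are (1), (2) or (2,1), which is
-- exactly the positional system h : 0 ↦ 00, 1 ↦ 01, 2 ↦ 10; this is checked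
-- exhaustively over the 16 letters.
module Submission where

open import Defs
open import Data.Nat using (ℕ; _<_)
open import Data.Nat.Properties using (allUpTo?)
open import Data.Fin.Properties using (all?; _≟_)
open import Data.Bool using (Bool)
open import Data.List using (_∷_; [])
open import Data.Maybe using (Maybe; just; nothing; map; _>>=_)
open import Data.Product using (Σ; _×_; _,_)
open import Relation.Binary.Definitions using (DecidableEquality)
open import Relation.Binary.PropositionalEquality using (_≡_; refl; trans; cong)
open import Relation.Nullary using (Dec; yes; no)
open import Relation.Nullary.Decidable using (toWitness)

SameDefined : {A : Set} → Maybe A → Maybe A → Set
SameDefined {A} m m′ = Σ A λ b → m ≡ just b × m′ ≡ just b

sameDefined? : {A : Set} → DecidableEquality A → (m m′ : Maybe A) → Dec (SameDefined m m′)
sameDefined? _≟ᴬ_ (just a) (just a′) with a ≟ᴬ a′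
... | yes refl = yes (a , refl , refl)
... | no a≢a′  = no λ { (_ , refl , refl) → a≢a′ refl }
sameDefined? _ (just _) nothing  = no λ { (_ , _ , ()) }
sameDefined? _ nothing  _        = no λ { (_ , () , _) }

twoLevelLookup : H → (Bool × Bool) → (Bool × Bool) → Maybe H
twoLevelLookup r (x₁ , y₁) (x₂ , y₂) =
  φ r [ bitℕ x₁ , bitℕ y₁ ] >>= λ a → φ a [ bitℕ x₂ , bitℕ y₂ ]

run-twoLetters : ∀ r x₁ y₁ x₂ y₂ →
  run (st r) ((x₁ , y₁) ∷ (x₂ , y₂) ∷ []) ≡ map st (twoLevelLookup r (x₁ , y₁) (x₂ , y₂))
run-twoLetters r x₁ y₁ x₂ y₂ with φ r [ bitℕ x₁ , bitℕ y₁ ]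
... | nothing = refl
... | just a with φ a [ bitℕ x₂ , bitℕ y₂ ]
...   | nothing = refl
...   | just _  = refl

φ²-at-h : H → ℕ → ℕ → Maybe H
φ²-at-h r ℓ₁ ℓ₂ = hdig ℓ₁ >>= λ { (x₁ , x₂) → hdig ℓ₂ >>= λ { (y₁ , y₂) →
  twoLevelLookup r (x₁ , y₁) (x₂ , y₂) } }

runM-h : ∀ r ℓ₁ ℓ₂ → runM (st r) (h ℓ₁ ℓ₂) ≡ map st (φ²-at-h r ℓ₁ ℓ₂)
runM-h r ℓ₁ ℓ₂ with hdig ℓ₁
... | nothing = refl
... | just (x₁ , x₂) with hdig ℓ₂
...   | nothing = refl
...   | just (y₁ , y₂) = run-twoLetters r x₁ y₁ x₂ y₂

φ²-at≡φ²-at-h : ∀ r {ℓ₁} → ℓ₁ < width-φ² r → ∀ {ℓ₂} → ℓ₂ < height-φ² r →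
  SameDefined (φ²-at r ℓ₁ ℓ₂) (φ²-at-h r ℓ₁ ℓ₂)
φ²-at≡φ²-at-h = toWitness {a? = all? λ r →
  allUpTo? (λ ℓ₁ → allUpTo? (λ ℓ₂ → sameDefined? _≟_ (φ²-at r ℓ₁ ℓ₂) (φ²-at-h r ℓ₁ ℓ₂))
                             (height-φ² r))
           (width-φ² r)} _

lemma5 : (r : H) (ℓ₁ ℓ₂ : ℕ) → ℓ₁ < width-φ² r → ℓ₂ < height-φ² r →
    Σ H (λ b → (φ²-at r ℓ₁ ℓ₂ ≡ just b) × (runM (st r) (h ℓ₁ ℓ₂) ≡ just (st b)))
lemma5 r ℓ₁ ℓ₂ ℓ₁<w ℓ₂<h with φ²-at≡φ²-at-h r ℓ₁<w ℓ₂<h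
... | b , φ²-at≡b , φ²-at-h≡b = b , φ²-at≡b , trans (runM-h r ℓ₁ ℓ₂) (cong (map st) φ²-at-h≡b)
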